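{- Let $p\ge 3$ be a prime. The class $\mathcal{P}_{\mathrm{GS}(p)}$ is an obstruction to linear atomicity.
   Context: For $n\ge1$ and $1\le i\le n$ let $H_i=\{x\in\mathbb{F}_p^n: x_1=\dots=x_i=0\}$ and let $e_i$ be the $i$-th standard basis vector. Let $A_{\mathrm{GS}}(n,p)=\bigcup_{i=1}^n(H_i+e_i)$ and $\mathrm{GS}(n,p)=(\mathbb{F}_p^n,A_{\mathrm{GS}}(n,p))$. $\mathcal{P}_{\mathrm{GS}(p)}$ is the closure of $\{\mathrm{GS}(n,p):n\ge1\}$ under isomorphism, where an isomorphism $(G,A)\to(G',A')$ of pairs (finite group, subset) is a bijection $f:G\to G'$ with $f(x+y)=f(x)-f(0)+f(y)$ and $x\in A\iff f(x)\in A'$. An elementary $p$-group property (epGP) is a class of pairs $(G,A)$, $G$ a finite elementary abelian $p$-group and $A\subseteq G$, closed under isomorphism; $\mathcal{P}_n$ denotes its members with $G=\mathbb{F}_p^n$. A partition $\mathcal{X}$ of $G$ is $\epsilon$-atomic w.r.t. $A$ if each $X\in\mathcal{X}$ has $|A\cap X|/|X|\in[0,\epsilon)\cup(1-\epsilon,1]$. An epGP $\mathcal{P}$ is linearly atomic if for every $\epsilon>0$ there is $K$ such that for all $(G,A)\in\mathcal{P}$ with $G$ sufficiently large there is a subgroup $H\le G$ of index at most $K$ whose coset partition is $\epsilon$-atomic w.r.t. $A$. An epGP $\mathcal{P}$ is an obstruction to linear atomicity if $\mathcal{P}_n\neq\emptyset$ for arbitrarily large $n$ and for every linearly atomic epGP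 $\mathcal{H}$ there is $N$ with $\mathcal{P}_n\cap\mathcal{H}_n=\emptyset$ for all $n\ge N$. -}

module Defs where

open import Data.Nat using (ℕ; zero; suc; _+_; _*_; _∸_; _^_; _≤_; _<_; NonZero)
open import Data.Nat.DivMod using (_mod_)
open import Data.Fin using (Fin; toℕ)
open import Data.Fin.Properties using () renaming (_≟_ to _≟F_)
open import Data.Bool using (Bool; true; false; if_then_else_; _∧_)
open import Data.List using (List; []; _∷_; map; concatMap; allFin)
open import Data.Nat.ListAction using (sum)
open import Data.Bool.ListAction using (any; all)
open import Data.Vec using (Vec; []; _∷_; zipWith; replicate; tabulate; lookup)
open import Data.Product using (Σ; ∃; _×_; _,_)
open import Data.Sum using (_⊎_)
open import Data.Empty using (⊥)
open import Relation.Nullary.Decidable using (⌊_⌋)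
open import Relation.Binary.PropositionalEquality using (_≡_)
open import Level using (Level; suc; _⊔_) renaming (zero to lzero)

module _ (p : ℕ) .{{_ : NonZero p}} where

  _+ₚ_ : Fin p → Fin p → Fin p
  a +ₚ b = (toℕ a + toℕ b) mod p

  _-ₚ_ : Fin p → Fin p → Fin p
  a -ₚ b = (toℕ a + (p ∸ toℕ b)) mod p

  0ₚ 1ₚ : Fin p
  0ₚ = 0 mod p
  1ₚ = 1 mod p

  V : ℕ → Set
  V n = Vec (Fin p) n

  _⊕_ : ∀ {n} → V n → V n → V n
  _⊕_ = zipWith _+ₚ_

  _⊖_ : ∀ {n} → V n → V n → V n
  _⊖_ = zipWith _-ₚ_

  0v : ∀ {n} → V n
  0v = replicate _ 0ₚ

  Subset : ℕ → Set
  Subset n = V n → Bool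

  allV : ∀ n → List (V n)
  allV zero = [] ∷ []
  allV (suc n) = concatMap (λ a → map (a ∷_) (allV n)) (allFin p)

  card : ∀ {n} → Subset n → ℕ
  card {n} S = sum (map (λ x → if S x then 1 else 0) (allV n))

  record Iso {n m : ℕ} (A : Subset n) (B : Subset m) : Set where
    field
      f      : V n → V m
      g      : V m → V n
      g∘f    : ∀ x → g (f x) ≡ x
      f∘g    : ∀ y → f (g y) ≡ y
      affine : ∀ x y → f (x ⊕ y) ≡ ((f x ⊖ f 0v) ⊕ f y)
      pres   : ∀ x → A x ≡ B (f x)

  -- an elementary p-group property, given by its members on F_p^n for each n
  Class : (ℓ : Level) → Set (Level.suc ℓ)
  Class ℓ = (n : ℕ) → Subset n → Set ℓ

  IsEPGP : ∀ {ℓ} → Class ℓ → Set ℓ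
  IsEPGP P = ∀ {n m} (A : Subset n) (B : Subset m) → Iso A B → P n A → P m B

  record IsSubgroup {n : ℕ} (H : Subset n) : Set where
    field
      has-0 : H 0v ≡ true
      ⊕-closed : ∀ x y → H x ≡ true → H y ≡ true → H (x ⊕ y) ≡ true
      ⊖-closed : ∀ x → H x ≡ true → H (0v ⊖ x) ≡ true

  -- index of H in F_p^n is at most K  (index = p^n / |H|)
  IndexAtMost : ∀ {n} → Subset n → ℕ → Set
  IndexAtMost {n} H K = p ^ n ≤ K * card H

  -- the coset partition {x + H} is ε-atomic w.r.t. A, where ε = a / b:
  -- for each coset X = x + H = {y : y - x ∈ H}, with c = |A ∩ X|,
  -- c/|X| < ε  or  c/|X| > 1 - ε   (cleared of denominators)
  CosetsAtomic : ∀ {n} (a b : ℕ) (A H : Subset n) → Set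
  CosetsAtomic {n} a b A H = ∀ (x : V n) →
    let X = λ y → H (y ⊖ x)
        c = card (λ y → X y ∧ A y)
        s = card X
    in (c * b < a * s) ⊎ (b * s < c * b + a * s)

  -- linearly atomic (ε ranging over positive rationals a/b)
  LinearlyAtomic : ∀ {ℓ} → Class ℓ → Set ℓ
  LinearlyAtomic P = ∀ (a b : ℕ) → 0 < a → 0 < b →
    Σ ℕ λ K → Σ ℕ λ N → ∀ n → N ≤ n → ∀ (A : Subset n) → P n A →
      Σ (Subset n) λ H → IsSubgroup H × IndexAtMost H K × CosetsAtomic a b A H

  ObstructionToLinearAtomicity : ∀ {ℓ} (ℓ' : Level) → Class ℓ → Set (ℓ ⊔ Level.suc ℓ')
  ObstructionToLinearAtomicity ℓ' P =
    (∀ N → Σ ℕ λ n → N ≤ n × Σ (Subset n) λ A → P n A) ×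
    (∀ (H : Class ℓ') → IsEPGP H → LinearlyAtomic H →
      Σ ℕ λ N → ∀ n → N ≤ n → ∀ (A : Subset n) → P n A → H n A → ⊥)

  -- standard basis vector e_i (0-based index i)
  e : ∀ {n} → Fin n → V n
  e i = tabulate (λ j → if ⌊ j ≟F i ⌋ then 1ₚ else 0ₚ)

  -- H_i = {x : x_1 = … = x_i = 0}; membership test (i is 0-based here, i.e. H_{i+1})
  inH : ∀ {n} → Fin n → V n → Bool
  inH {n} i x = all (λ j → if ⌊ toℕ j Data.Nat.≤? toℕ i ⌋ then ⌊ lookup x j ≟F 0ₚ ⌋ else true) (allFin n)

  -- A_GS(n,p) = ⋃_i (H_i + e_i)
  A-GS : (n : ℕ) → Subset n
  A-GS n x = any (λ i → inH i (x ⊖ e i)) (allFin n)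

  P-GS : Class lzero
  P-GS n A = Σ ℕ λ m → 1 ≤ m × Iso (A-GS m) A

{-# OPTIONS --safe #-}
module Submission where

-- Isomorphisms preserve |G|, so a member of P_GS(p) on F_p^n is isomorphic to GS(n,p), and an
-- isomorphism-closed linearly atomic class containing it contains GS(n,p). With ε = 1/p, linear
-- atomicity then yields a subgroup S of index at most K < p^n, hence S ≠ 0. Let j be the first
-- coordinate on which S does not vanish. Every y ∈ S vanishes below j, so y_j = 1 forces y ∈ A_GS,
-- and y ∈ A_GS forces y_j ∈ {0, 1}. Translating by some u ∈ S with u_j ≠ 0 shows that the fibres of
-- y ↦ y_j on S all have the same size (u_j generates F_p as p is prime), namely |S|/p. Hence |A_GS ∩
-- S|/|S| lies in [1/p, 2/p], and for p ≥ 3 the coset S is not ε-atomic.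

open import Level using (Level)
open import Function using (_∘_; _⇔_; mk⇔; Equivalence)
open import Function.Properties.Equivalence using () renaming (trans to ⇔-trans)
open import Algebra.Properties.CommutativeSemigroup using (interchange)
open import Data.Empty using (⊥; ⊥-elim)
open import Data.Bool using (Bool; true; false; if_then_else_; _∧_; T)
open import Data.Bool.Properties using (T-≡) renaming (_≟_ to _≟ᴮ_)
open import Data.Nat using (ℕ; zero; suc; _+_; _*_; _∸_; _^_; _≤_; _<_; NonZero; z≤n; s≤s; _%_; _≤?_; _<?_; ≢-nonZero; >-nonZero; >-nonZero⁻¹)
open import Data.Nat.Properties
  using (+-identityʳ; +-assoc; +-comm; +-suc; +-mono-≤; +-monoˡ-≤; *-identityˡ; *-identityʳ; *-comm; *-monoʳ-≤; *-monoˡ-≤;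
         ≤-refl; ≤-trans; ≤-reflexive; <-irrefl; <-≤-trans; <⇒≤; <⇒≢; <⇒≱; ≮⇒≥; ≤∧≢⇒<; <-cmp; m≤m+n; m≤n+m; n≤1+n;
         m+[n∸m]≡n; m∸n+n≡m; ^-monoʳ-<; ^-monoʳ-≤; m^n>0; +-commutativeSemigroup; module ≤-Reasoning)
open import Data.Nat.DivMod using (_mod_; m%n<n; %-distribˡ-+; m%n%n≡m%n; [m+n]%n≡m%n; n%n≡0; m<n⇒m%n≡m)
open import Data.Nat.ListAction using (sum)
open import Data.Nat.ListAction.Properties using (sum-++)
open import Data.Nat.Primality using (Prime)
open import Data.Nat.Coprimality using (Coprime; coprime-Bézout; prime⇒coprime)
open import Data.Nat.GCD using (module Bézout)
open import Data.Fin using (Fin; zero; suc; toℕ; fromℕ<; inject)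
open import Data.Fin.Properties using (_≟_; toℕ-injective; toℕ-fromℕ<; toℕ<n; toℕ-inject; ¬∀⟶∃¬-smallest)
open import Data.List using (List; []; _∷_; map; _++_; concatMap; allFin)
open import Data.List.Properties using (map-cong; map-∘; map-++; map-tabulate)
open import Data.List.Membership.Propositional using (_∈_)
open import Data.List.Membership.Propositional.Properties using (∈-allFin; ∈-map⁺; ∈-concatMap⁺)
open import Data.List.Relation.Unary.Any as Any using (here)
open import Data.List.Relation.Unary.Any.Properties using (any⁺; any⁻)
open import Data.List.Relation.Unary.All as All using ()
open import Data.List.Relation.Unary.All.Properties using (all⁺; all⁻; ¬All⇒Any¬)
open import Data.Vec using (Vec; []; _∷_; lookup; zipWith)
open import Data.Vec.Properties using (≡-dec; lookup-zipWith; lookup∘tabulate; zipWith-identityʳ)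
open import Data.Product using (Σ; ∃; _×_; _,_)
open import Data.Sum using (_⊎_; inj₁; inj₂)
open import Relation.Nullary using (¬_; Dec; yes; no; does)
open import Relation.Nullary.Decidable using (⌊_⌋; isYes≗does; map′; does-⇔; dec-true; dec-false; _→-dec_)
open import Relation.Binary.Definitions using (DecidableEquality; tri<; tri≈; tri>)
open import Relation.Binary.PropositionalEquality using (_≡_; _≢_; refl; sym; trans; cong; cong₂; subst; subst₂; module ≡-Reasoning)
open import Defs hiding (_+ₚ_; _-ₚ_; 0ₚ; 1ₚ; _⊕_; _⊖_; 0v)
import Defs

-- Finite sums

𝟙 : Bool → ℕ
𝟙 b = if b then 1 else 0

∑ : ∀ {A : Set} → List A → (A → ℕ) → ℕ
∑ xs f = sum (map f xs)

syntax ∑ xs (λ x → e) = ∑[ x ∈ xs ] e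

private variable A B : Set

∑-cong : ∀ (xs : List A) {f g : A → ℕ} → (∀ x → f x ≡ g x) → ∑ xs f ≡ ∑ xs g
∑-cong xs f≗g = cong sum (map-cong f≗g xs)

∑-mono-≤ : ∀ (xs : List A) {f g : A → ℕ} → (∀ x → f x ≤ g x) → ∑ xs f ≤ ∑ xs g
∑-mono-≤ []       f≤g = z≤n
∑-mono-≤ (x ∷ xs) f≤g = +-mono-≤ (f≤g x) (∑-mono-≤ xs f≤g)

∑-zero : ∀ (xs : List A) → ∑[ x ∈ xs ] 0 ≡ 0
∑-zero []       = refl
∑-zero (x ∷ xs) = ∑-zero xs

∑-distrib-+ : ∀ (xs : List A) (f g : A → ℕ) → ∑[ x ∈ xs ] (f x + g x) ≡ ∑ xs f + ∑ xs g
∑-distrib-+ []       f g = refl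
∑-distrib-+ (x ∷ xs) f g =
  trans (cong (f x + g x +_) (∑-distrib-+ xs f g))
        (interchange +-commutativeSemigroup (f x) (g x) (∑ xs f) (∑ xs g))

∑-++ : ∀ (xs ys : List A) (f : A → ℕ) → ∑ (xs ++ ys) f ≡ ∑ xs f + ∑ ys f
∑-++ xs ys f = trans (cong sum (map-++ f xs ys)) (sum-++ (map f xs) (map f ys))

∑-map : (g : A → B) (xs : List A) (f : B → ℕ) → ∑ (map g xs) f ≡ ∑ xs (f ∘ g)
∑-map g xs f = cong sum (sym (map-∘ xs))

∑-concatMap : (g : A → List B) (xs : List A) (f : B → ℕ) →
  ∑ (concatMap g xs) f ≡ ∑[ x ∈ xs ] ∑ (g x) f
∑-concatMap g []       f = refl
∑-concatMap g (x ∷ xs) f =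
  trans (∑-++ (g x) (concatMap g xs) f) (cong (∑ (g x) f +_) (∑-concatMap g xs f))

∑-comm : (xs : List A) (ys : List B) (h : A → B → ℕ) →
  ∑[ x ∈ xs ] ∑[ y ∈ ys ] h x y ≡ ∑[ y ∈ ys ] ∑[ x ∈ xs ] h x y
∑-comm []       ys h = sym (∑-zero ys)
∑-comm (x ∷ xs) ys h =
  trans (cong (∑ ys (h x) +_) (∑-comm xs ys h)) (sym (∑-distrib-+ ys (h x) _))

∑-allFin-suc : ∀ k (f : Fin (suc k) → ℕ) → ∑ (allFin (suc k)) f ≡ f zero + ∑[ i ∈ allFin k ] f (suc i)
∑-allFin-suc k f = cong (f zero +_) (begin
  ∑ (Data.List.tabulate suc) f     ≡⟨ cong (λ xs → ∑ xs f) (map-tabulate (λ i → i) (Fin.suc {k})) ⟨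
  ∑ (map suc (allFin k)) f         ≡⟨ ∑-map suc (allFin k) f ⟩
  ∑[ i ∈ allFin k ] f (suc i)      ∎)
  where open ≡-Reasoning

∑-allFin-const : ∀ k c → ∑[ t ∈ allFin k ] c ≡ k * c
∑-allFin-const zero    c = refl
∑-allFin-const (suc k) c = trans (∑-allFin-suc k (λ _ → c)) (cong (c +_) (∑-allFin-const k c))

-- `does` rather than ⌊_⌋ in what follows: it computes through `map′`, so
-- does (suc a ≟ suc t) and does (a ≟ t) agree by refl.
∑-allFin-δ : ∀ k (a : Fin k) (h : Fin k → ℕ) → ∑[ t ∈ allFin k ] (if does (a ≟ t) then h t else 0) ≡ h a
∑-allFin-δ (suc k) zero    h =
  trans (∑-allFin-suc k _) (trans (cong (h zero +_) (∑-zero (allFin k))) (+-identityʳ (h zero)))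
∑-allFin-δ (suc k) (suc a) h =
  trans (∑-allFin-suc k (λ t → if does (suc a ≟ t) then h t else 0)) (∑-allFin-δ k a (λ t → h (suc t)))

T-if⇔→ : ∀ {P Q : Set} (P? : Dec P) (Q? : Dec Q) → T (if ⌊ P? ⌋ then ⌊ Q? ⌋ else true) ⇔ (P → Q)
T-if⇔→ (yes p) (yes q) = mk⇔ (λ _ _ → q) (λ _ → _)
T-if⇔→ (yes p) (no ¬q) = mk⇔ (λ ()) (λ p→q → ¬q (p→q p))
T-if⇔→ (no ¬p) Q?      = mk⇔ (λ _ p → ⊥-elim (¬p p)) (λ _ → _)

𝟙-∧ : ∀ s d → (if d then 𝟙 s else 0) ≡ 𝟙 (s ∧ d)
𝟙-∧ true  true  = refl
𝟙-∧ true  false = refl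
𝟙-∧ false true  = refl
𝟙-∧ false false = refl

-- Arithmetic

module _ {X : Set} (G : ℕ → X) where

  periodic-multiples : ∀ {a} → (∀ m → G (m + a) ≡ G m) → ∀ k m → G (m + k * a) ≡ G m
  periodic-multiples per zero    m = cong G (+-identityʳ m)
  periodic-multiples {a} per (suc k) m =
    trans (cong G (sym (+-assoc m a (k * a)))) (trans (periodic-multiples per k (m + a)) (per m))

  coprime-periods⇒constant : ∀ {a b} → Coprime a b →
    (∀ m → G (m + a) ≡ G m) → (∀ m → G (m + b) ≡ G m) → ∀ m → G m ≡ G 0
  coprime-periods⇒constant {a} {b} a⊥b per-a per-b = constant
    where
    unit-period : ∀ {c d} → (∀ m → G (m + c) ≡ G m) → (∀ m → G (m + d) ≡ G m) →
      ∀ x y → 1 + y * d ≡ x * c → ∀ m → G (suc m) ≡ G m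
    unit-period {c} {d} per-c per-d x y eq m = begin
      G (suc m)             ≡⟨ periodic-multiples per-d y (suc m) ⟨
      G (suc m + y * d)     ≡⟨ cong G (trans (sym (+-suc m (y * d))) (cong (m +_) eq)) ⟩
      G (m + x * c)         ≡⟨ periodic-multiples per-c x m ⟩
      G m                   ∎
      where open ≡-Reasoning

    step : ∀ m → G (suc m) ≡ G m
    step with coprime-Bézout a⊥b
    ... | Bézout.+- x y eq = unit-period per-a per-b x y eq
    ... | Bézout.-+ x y eq = unit-period per-b per-a y x eq

    constant : ∀ m → G m ≡ G 0
    constant zero    = refl
    constant (suc m) = trans (step m) (constant m)

^-injectiveʳ : ∀ b {m n} → 1 < b → b ^ m ≡ b ^ n → m ≡ n
^-injectiveʳ b {m} {n} 1<b eq with <-cmp m n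
... | tri< m<n _ _ = ⊥-elim (<-irrefl eq (^-monoʳ-< b 1<b m<n))
... | tri≈ _ m≡n _ = m≡n
... | tri> _ _ n<m = ⊥-elim (<-irrefl (sym eq) (^-monoʳ-< b 1<b n<m))

n<b^n : ∀ {b} → 1 < b → ∀ n → n < b ^ n
n<b^n 1<b zero    = s≤s z≤n
n<b^n {b} 1<b (suc n) = begin-strict
  suc n              <⟨ s≤s (n<b^n 1<b n) ⟩
  suc (b ^ n)        ≤⟨ +-monoˡ-≤ (b ^ n) (m^n>0 b {{>-nonZero (<⇒≤ 1<b)}} n) ⟩
  b ^ n + b ^ n      ≡⟨ cong (b ^ n +_) (+-identityʳ (b ^ n)) ⟨
  2 * b ^ n          ≤⟨ *-monoˡ-≤ (b ^ n) 1<b ⟩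
  b * b ^ n          ∎
  where open ≤-Reasoning

m≤n*o∧n<m⇒1<o : ∀ {m n o} → m ≤ n * o → n < m → 1 < o
m≤n*o∧n<m⇒1<o {m} {n} {o} m≤no n<m with 1 <? o
... | yes 1<o = 1<o
... | no 1≮o  = ⊥-elim (<-irrefl refl (begin-strict
  n        <⟨ n<m ⟩
  m        ≤⟨ m≤no ⟩
  n * o    ≤⟨ *-monoʳ-≤ n (≮⇒≥ 1≮o) ⟩
  n * 1    ≡⟨ *-identityʳ n ⟩
  n        ∎))
  where open ≤-Reasoning

-- With |S| = q f and c = |A ∩ S|, the two disjuncts say c/|S| < 1/q or c/|S| > 1 − 1/q,
-- while f ≤ c ≤ 2f puts c/|S| in [1/q, 2/q].
proportion-not-extreme : ∀ {q f c} → 3 ≤ q → f ≤ c → c ≤ f + f →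
  ¬ ((c * q < 1 * (q * f)) ⊎ (q * (q * f) < c * q + 1 * (q * f)))
proportion-not-extreme {q} {f} {c} 3≤q f≤c c≤2f (inj₁ below) = <-irrefl refl (begin-strict
  c * q        <⟨ below ⟩
  1 * (q * f)  ≡⟨ *-identityˡ (q * f) ⟩
  q * f        ≤⟨ *-monoʳ-≤ q f≤c ⟩
  q * c        ≡⟨ *-comm q c ⟩
  c * q        ∎)
  where open ≤-Reasoning
proportion-not-extreme {q} {f} {c} 3≤q f≤c c≤2f (inj₂ above) = <-irrefl refl (begin-strict
  q * (q * f)                  <⟨ above ⟩
  c * q + 1 * (q * f)          ≤⟨ +-monoˡ-≤ (1 * (q * f)) (*-monoˡ-≤ q c≤2f) ⟩
  (f + f) * q + 1 * (q * f)    ≡⟨ [f+f]q+qf≡3qf f q ⟩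
  3 * (q * f)                  ≤⟨ *-monoˡ-≤ (q * f) 3≤q ⟩
  q * (q * f)                  ∎)
  where
  open ≤-Reasoning
  open import Data.Nat.Tactic.RingSolver using (solve-∀)
  [f+f]q+qf≡3qf : ∀ f q → (f + f) * q + 1 * (q * f) ≡ 3 * (q * f)
  [f+f]q+qf≡3qf = solve-∀

zipWith-cancelʳ : ∀ {f g : A → A → A} → (∀ a b → f (g a b) b ≡ a) →
  ∀ {n} (xs ys : Vec A n) → zipWith f (zipWith g xs ys) ys ≡ xs
zipWith-cancelʳ cancel []       []       = refl
zipWith-cancelʳ cancel (x ∷ xs) (y ∷ ys) = cong₂ _∷_ (cancel x y) (zipWith-cancelʳ cancel xs ys)

-- F_p and F_p^n

module _ (p : ℕ) .{{_ : NonZero p}} where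

  infixl 6 _+ₚ_ _-ₚ_ _⊕_ _⊖_

  _+ₚ_ _-ₚ_ : Fin p → Fin p → Fin p
  _+ₚ_ = Defs._+ₚ_ p
  _-ₚ_ = Defs._-ₚ_ p

  0ₚ 1ₚ : Fin p
  0ₚ = Defs.0ₚ p
  1ₚ = Defs.1ₚ p

  _⊕_ _⊖_ : ∀ {n} → V p n → V p n → V p n
  _⊕_ = Defs._⊕_ p
  _⊖_ = Defs._⊖_ p

  0v : ∀ {n} → V p n
  0v = Defs.0v p

  toℕ-mod : ∀ m → toℕ (m mod p) ≡ m % p
  toℕ-mod m = toℕ-fromℕ< (m%n<n m p)

  mod-cong : ∀ {m k} → m % p ≡ k % p → m mod p ≡ k mod p
  mod-cong eq = toℕ-injective (trans (toℕ-mod _) (trans eq (sym (toℕ-mod _))))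

  mod-toℕ : ∀ a → toℕ a mod p ≡ a
  mod-toℕ a = toℕ-injective (trans (toℕ-mod (toℕ a)) (m<n⇒m%n≡m (toℕ<n a)))

  mod-absorbˡ : ∀ m k → (toℕ (m mod p) + k) mod p ≡ (m + k) mod p
  mod-absorbˡ m k = mod-cong (begin
    (toℕ (m mod p) + k) % p        ≡⟨ cong (λ r → (r + k) % p) (toℕ-mod m) ⟩
    (m % p + k) % p                ≡⟨ %-distribˡ-+ (m % p) k p ⟩
    (m % p % p + k % p) % p        ≡⟨ cong (λ r → (r + k % p) % p) (m%n%n≡m%n m p) ⟩
    (m % p + k % p) % p            ≡⟨ %-distribˡ-+ m k p ⟨
    (m + k) % p                    ∎)
    where open ≡-Reasoning

  mod-absorbʳ : ∀ m k → (m + toℕ (k mod p)) mod p ≡ (m + k) mod p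
  mod-absorbʳ m k = begin
    (m + toℕ (k mod p)) mod p   ≡⟨ cong (_mod p) (+-comm m _) ⟩
    (toℕ (k mod p) + m) mod p   ≡⟨ mod-absorbˡ k m ⟩
    (k + m) mod p               ≡⟨ cong (_mod p) (+-comm k m) ⟩
    (m + k) mod p               ∎
    where open ≡-Reasoning

  mod-+p : ∀ m → (m + p) mod p ≡ m mod p
  mod-+p m = mod-cong ([m+n]%n≡m%n m p)

  toℕ-0ₚ : toℕ 0ₚ ≡ 0
  toℕ-0ₚ = trans (toℕ-mod 0) (m<n⇒m%n≡m (>-nonZero⁻¹ p))

  1ₚ≢0ₚ : 1 < p → 1ₚ ≢ 0ₚ
  1ₚ≢0ₚ 1<p 1≡0 = 1≢0 (begin
    1            ≡⟨ m<n⇒m%n≡m 1<p ⟨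
    1 % p        ≡⟨ toℕ-mod 1 ⟨
    toℕ 1ₚ       ≡⟨ cong toℕ 1≡0 ⟩
    toℕ 0ₚ       ≡⟨ toℕ-0ₚ ⟩
    0            ∎)
    where
    open ≡-Reasoning
    1≢0 : 1 ≢ 0
    1≢0 ()

  -ₚ-identityʳ : ∀ a → a -ₚ 0ₚ ≡ a
  -ₚ-identityʳ a = begin
    (toℕ a + (p ∸ toℕ 0ₚ)) mod p   ≡⟨ cong (λ z → (toℕ a + (p ∸ z)) mod p) toℕ-0ₚ ⟩
    (toℕ a + p) mod p              ≡⟨ mod-+p (toℕ a) ⟩
    toℕ a mod p                    ≡⟨ mod-toℕ a ⟩
    a                              ∎
    where open ≡-Reasoning

  +ₚ-identityʳ : ∀ a → a +ₚ 0ₚ ≡ a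
  +ₚ-identityʳ a = trans (cong (λ z → (toℕ a + z) mod p) toℕ-0ₚ)
                         (trans (cong (_mod p) (+-identityʳ (toℕ a))) (mod-toℕ a))

  -ₚ-+ₚ : ∀ a b → (a -ₚ b) +ₚ b ≡ a
  -ₚ-+ₚ a b = begin
    (toℕ ((toℕ a + (p ∸ toℕ b)) mod p) + toℕ b) mod p   ≡⟨ mod-absorbˡ _ (toℕ b) ⟩
    (toℕ a + (p ∸ toℕ b) + toℕ b) mod p                 ≡⟨ cong (_mod p) (+-assoc (toℕ a) _ _) ⟩
    (toℕ a + ((p ∸ toℕ b) + toℕ b)) mod p               ≡⟨ cong (λ z → (toℕ a + z) mod p) (m∸n+n≡m (<⇒≤ (toℕ<n b))) ⟩
    (toℕ a + p) mod p                                   ≡⟨ mod-+p (toℕ a) ⟩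
    toℕ a mod p                                         ≡⟨ mod-toℕ a ⟩
    a                                                   ∎
    where open ≡-Reasoning

  +ₚ--ₚ : ∀ a b → (a +ₚ b) -ₚ b ≡ a
  +ₚ--ₚ a b = begin
    (toℕ ((toℕ a + toℕ b) mod p) + (p ∸ toℕ b)) mod p   ≡⟨ mod-absorbˡ _ (p ∸ toℕ b) ⟩
    (toℕ a + toℕ b + (p ∸ toℕ b)) mod p                 ≡⟨ cong (_mod p) (+-assoc (toℕ a) _ _) ⟩
    (toℕ a + (toℕ b + (p ∸ toℕ b))) mod p               ≡⟨ cong (λ z → (toℕ a + z) mod p) (m+[n∸m]≡n (<⇒≤ (toℕ<n b))) ⟩
    (toℕ a + p) mod p                                   ≡⟨ mod-+p (toℕ a) ⟩
    toℕ a mod p                                         ≡⟨ mod-toℕ a ⟩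
    a                                                   ∎
    where open ≡-Reasoning

  -ₚ-self : ∀ a → a -ₚ a ≡ 0ₚ
  -ₚ-self a = mod-cong (trans (cong (_% p) (m+[n∸m]≡n (<⇒≤ (toℕ<n a))))
                              (trans (n%n≡0 p) (sym (m<n⇒m%n≡m (>-nonZero⁻¹ p)))))

  -ₚ≡0ₚ⇒≡ : ∀ {a b} → a -ₚ b ≡ 0ₚ → a ≡ b
  -ₚ≡0ₚ⇒≡ {a} {b} a-b≡0 = begin
    a                ≡⟨ -ₚ-+ₚ a b ⟨
    (a -ₚ b) +ₚ b    ≡⟨ cong (_+ₚ b) (trans a-b≡0 (sym (-ₚ-self b))) ⟩
    (b -ₚ b) +ₚ b    ≡⟨ -ₚ-+ₚ b b ⟩
    b                ∎
    where open ≡-Reasoning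

  +ₚ-cancelʳ : ∀ {a b} c → a +ₚ c ≡ b +ₚ c → a ≡ b
  +ₚ-cancelʳ {a} {b} c eq = trans (sym (+ₚ--ₚ a c)) (trans (cong (_-ₚ c) eq) (+ₚ--ₚ b c))

  -ₚ-as-+ₚ : ∀ a b → a -ₚ b ≡ a +ₚ (0ₚ -ₚ b)
  -ₚ-as-+ₚ a b = sym (trans (cong (λ z → (toℕ a + toℕ ((z + (p ∸ toℕ b)) mod p)) mod p) toℕ-0ₚ)
                            (mod-absorbʳ (toℕ a) (p ∸ toℕ b)))

  mod-+ₚ : ∀ m a → (m + toℕ a) mod p ≡ m mod p +ₚ a
  mod-+ₚ m a = sym (mod-absorbˡ m (toℕ a))

  ⊕-identityʳ : ∀ {n} (x : V p n) → x ⊕ 0v ≡ x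
  ⊕-identityʳ = zipWith-identityʳ +ₚ-identityʳ

  ⊖-identityʳ : ∀ {n} (x : V p n) → x ⊖ 0v ≡ x
  ⊖-identityʳ = zipWith-identityʳ -ₚ-identityʳ

  ⊖-⊕ : ∀ {n} (x z : V p n) → (x ⊖ z) ⊕ z ≡ x
  ⊖-⊕ = zipWith-cancelʳ -ₚ-+ₚ

  ⊕-⊖ : ∀ {n} (x z : V p n) → (x ⊕ z) ⊖ z ≡ x
  ⊕-⊖ = zipWith-cancelʳ +ₚ--ₚ

  ⊖-as-⊕ : ∀ {n} (x z : V p n) → x ⊖ z ≡ x ⊕ (0v ⊖ z)
  ⊖-as-⊕ []      []      = refl
  ⊖-as-⊕ (a ∷ x) (c ∷ z) = cong₂ _∷_ (-ₚ-as-+ₚ a c) (⊖-as-⊕ x z)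

  lookup-⊕ : ∀ {n} (x y : V p n) i → lookup (x ⊕ y) i ≡ lookup x i +ₚ lookup y i
  lookup-⊕ x y i = lookup-zipWith _+ₚ_ i x y

  lookup-⊖ : ∀ {n} (x y : V p n) i → lookup (x ⊖ y) i ≡ lookup x i -ₚ lookup y i
  lookup-⊖ x y i = lookup-zipWith _-ₚ_ i x y

  coordinates-zero⇒≡0v : ∀ {n} (x : V p n) → (∀ i → lookup x i ≡ 0ₚ) → x ≡ 0v
  coordinates-zero⇒≡0v []      _ = refl
  coordinates-zero⇒≡0v (a ∷ x) x≡0 = cong₂ _∷_ (x≡0 zero) (coordinates-zero⇒≡0v x (λ i → x≡0 (suc i)))

  allV-complete : ∀ {n} (x : V p n) → x ∈ allV p n
  allV-complete []      = here refl
  allV-complete (a ∷ x) =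
    ∈-concatMap⁺ (λ b → map (b ∷_) (allV p _)) (Any.map (λ { refl → ∈-map⁺ (a ∷_) (allV-complete x) }) (∈-allFin a))

  ∀ⱽ? : ∀ {n} {Q : V p n → Set} → (∀ x → Dec (Q x)) → Dec (∀ x → Q x)
  ∀ⱽ? {n} Q? = map′ (λ all x → All.lookup all (allV-complete x)) (λ all → All.tabulate (λ {x} _ → all x))
                    (All.all? Q? (allV p n))

  ¬∀ⱽ⇒∃¬ : ∀ {n} {Q : V p n → Set} → (∀ x → Dec (Q x)) → ¬ (∀ x → Q x) → ∃ λ x → ¬ Q x
  ¬∀ⱽ⇒∃¬ {n} Q? ¬∀Q =
    Any.satisfied (¬All⇒Any¬ Q? (allV p n) (λ all → ¬∀Q (λ x → All.lookup all (allV-complete x))))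

  ∑-allV-suc : ∀ n (f : V p (suc n) → ℕ) → ∑ (allV p (suc n)) f ≡ ∑[ a ∈ allFin p ] ∑[ x ∈ allV p n ] f (a ∷ x)
  ∑-allV-suc n f =
    trans (∑-concatMap (λ a → map (a ∷_) (allV p n)) (allFin p) f) (∑-cong (allFin p) (λ a → ∑-map (a ∷_) (allV p n) f))

  ∑-allV-1 : ∀ n → ∑[ x ∈ allV p n ] 1 ≡ p ^ n
  ∑-allV-1 zero    = refl
  ∑-allV-1 (suc n) =
    trans (∑-allV-suc n _) (trans (∑-cong (allFin p) (λ _ → ∑-allV-1 n)) (∑-allFin-const p (p ^ n)))

  _≟ⱽ_ : ∀ {n} → DecidableEquality (V p n)
  _≟ⱽ_ = ≡-dec _≟_

  ∑-allV-δ : ∀ n (x : V p n) (h : V p n → ℕ) → ∑[ y ∈ allV p n ] (if does (x ≟ⱽ y) then h y else 0) ≡ h x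
  ∑-allV-δ zero    []      h = +-identityʳ (h [])
  ∑-allV-δ (suc n) (a ∷ x) h =
    trans (∑-allV-suc n _) (trans (∑-cong (allFin p) head-matches) (∑-allFin-δ p a (λ b → h (b ∷ x))))
    where
    head-matches : ∀ b → ∑[ y ∈ allV p n ] (if does ((a ∷ x) ≟ⱽ (b ∷ y)) then h (b ∷ y) else 0)
                       ≡ (if does (a ≟ b) then h (b ∷ x) else 0)
    head-matches b with a ≟ b
    ... | yes refl = ∑-allV-δ n x (λ y → h (a ∷ y))
    ... | no _     = ∑-zero (allV p n)

  -- Both sides equal the double sum of [f x ≡ y] · h y.
  ∑-allV-bijection : ∀ {m n} (f : V p m → V p n) (g : V p n → V p m) →
    (∀ x → g (f x) ≡ x) → (∀ y → f (g y) ≡ y) →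
    ∀ (h : V p n → ℕ) → ∑[ x ∈ allV p m ] h (f x) ≡ ∑ (allV p n) h
  ∑-allV-bijection {m} {n} f g gf≗id fg≗id h = begin
    ∑[ x ∈ allV p m ] h (f x)
      ≡⟨ ∑-cong (allV p m) (λ x → ∑-allV-δ n (f x) h) ⟨
    ∑[ x ∈ allV p m ] ∑[ y ∈ allV p n ] (if does (f x ≟ⱽ y) then h y else 0)
      ≡⟨ ∑-comm (allV p m) (allV p n) _ ⟩
    ∑[ y ∈ allV p n ] ∑[ x ∈ allV p m ] (if does (f x ≟ⱽ y) then h y else 0)
      ≡⟨ ∑-cong (allV p n) (λ y → ∑-cong (allV p m) (λ x → cong (λ b → if b then h y else 0) (f≡⇔g≡ x y))) ⟩
    ∑[ y ∈ allV p n ] ∑[ x ∈ allV p m ] (if does (g y ≟ⱽ x) then h y else 0)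
      ≡⟨ ∑-cong (allV p n) (λ y → ∑-allV-δ m (g y) (λ _ → h y)) ⟩
    ∑ (allV p n) h
      ∎
    where
    open ≡-Reasoning
    f≡⇔g≡ : ∀ x y → does (f x ≟ⱽ y) ≡ does (g y ≟ⱽ x)
    f≡⇔g≡ x y = does-⇔ (mk⇔ (λ { refl → gf≗id x }) (λ { refl → fg≗id y })) (f x ≟ⱽ y) (g y ≟ⱽ x)

  Iso-refl : ∀ {n} (A : Subset p n) → Iso p A A
  Iso-refl A = record
    { f = λ x → x ; g = λ x → x ; g∘f = λ _ → refl ; f∘g = λ _ → refl
    ; affine = λ x y → cong (_⊕ y) (sym (⊖-identityʳ x)) ; pres = λ _ → refl }

  Iso-sym : ∀ {m n} {A : Subset p m} {B : Subset p n} → Iso p A B → Iso p B A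
  Iso-sym {A = A} {B} A≅B = record
    { f = g ; g = f ; g∘f = f∘g ; f∘g = g∘f ; affine = g-affine
    ; pres = λ y → trans (cong B (sym (f∘g y))) (sym (pres (g y))) }
    where
    open Iso A≅B
    f-injective : ∀ {a b} → f a ≡ f b → a ≡ b
    f-injective {a} {b} eq = trans (sym (g∘f a)) (trans (cong g eq) (g∘f b))
    f-shift : ∀ x → f x ≡ f (x ⊖ g 0v) ⊖ f 0v
    f-shift x = begin
      f x                                   ≡⟨ cong f (⊖-⊕ x (g 0v)) ⟨
      f ((x ⊖ g 0v) ⊕ g 0v)                 ≡⟨ affine (x ⊖ g 0v) (g 0v) ⟩
      (f (x ⊖ g 0v) ⊖ f 0v) ⊕ f (g 0v)      ≡⟨ cong ((f (x ⊖ g 0v) ⊖ f 0v) ⊕_) (f∘g 0v) ⟩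
      (f (x ⊖ g 0v) ⊖ f 0v) ⊕ 0v            ≡⟨ ⊕-identityʳ _ ⟩
      f (x ⊖ g 0v) ⊖ f 0v                   ∎
      where open ≡-Reasoning
    g-affine : ∀ x y → g (x ⊕ y) ≡ (g x ⊖ g 0v) ⊕ g y
    g-affine x y = f-injective (begin
      f (g (x ⊕ y))                              ≡⟨ f∘g (x ⊕ y) ⟩
      x ⊕ y                                      ≡⟨ cong₂ _⊕_ (sym (f∘g x)) (sym (f∘g y)) ⟩
      f (g x) ⊕ f (g y)                          ≡⟨ cong (_⊕ f (g y)) (f-shift (g x)) ⟩
      (f (g x ⊖ g 0v) ⊖ f 0v) ⊕ f (g y)          ≡⟨ affine (g x ⊖ g 0v) (g y) ⟨
      f ((g x ⊖ g 0v) ⊕ g y)                     ∎)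
      where open ≡-Reasoning

  Iso⇒dim-≡ : 1 < p → ∀ {m n} {A : Subset p m} {B : Subset p n} → Iso p A B → m ≡ n
  Iso⇒dim-≡ 1<p {m} {n} A≅B = ^-injectiveʳ p 1<p (begin
    p ^ m                       ≡⟨ ∑-allV-1 m ⟨
    ∑[ x ∈ allV p m ] 1         ≡⟨ ∑-allV-bijection f g g∘f f∘g (λ _ → 1) ⟩
    ∑[ y ∈ allV p n ] 1         ≡⟨ ∑-allV-1 n ⟩
    p ^ n                       ∎)
    where
    open Iso A≅B
    open ≡-Reasoning

  -- The set A_GS

  ZeroBelow : ∀ {n} → Fin n → V p n → Set
  ZeroBelow i x = ∀ k → toℕ k < toℕ i → lookup x k ≡ 0ₚ

  inH⇔ : ∀ {n} (i : Fin n) (y : V p n) → inH p i y ≡ true ⇔ (∀ k → toℕ k ≤ toℕ i → lookup y k ≡ 0ₚ)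
  inH⇔ {n} i y = mk⇔
    (λ y∈H k → Equivalence.to (test⇔ k)
                 (All.lookup (all⁺ test (allFin n) (Equivalence.from T-≡ y∈H)) (∈-allFin k)))
    (λ zero-upto-i → Equivalence.to T-≡
       (all⁻ test {allFin n} (All.tabulate (λ {k} _ → Equivalence.from (test⇔ k) (zero-upto-i k)))))
    where
    test : Fin n → Bool
    test k = if ⌊ toℕ k ≤? toℕ i ⌋ then ⌊ lookup y k ≟ 0ₚ ⌋ else true
    test⇔ : ∀ k → T (test k) ⇔ (toℕ k ≤ toℕ i → lookup y k ≡ 0ₚ)
    test⇔ k = T-if⇔→ (toℕ k ≤? toℕ i) (lookup y k ≟ 0ₚ)

  lookup-⊖e : ∀ {n} (x : V p n) i k → lookup (x ⊖ e p i) k ≡ lookup x k -ₚ (if does (k ≟ i) then 1ₚ else 0ₚ)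
  lookup-⊖e x i k =
    trans (lookup-⊖ x (e p i) k) (cong (lookup x k -ₚ_) (trans (lookup∘tabulate _ k) (cong (if_then 1ₚ else 0ₚ) (isYes≗does (k ≟ i)))))

  lookup-⊖e-≢ : ∀ {n} (x : V p n) {i k} → k ≢ i → lookup (x ⊖ e p i) k ≡ lookup x k
  lookup-⊖e-≢ x {i} {k} k≢i = begin
    lookup (x ⊖ e p i) k                                    ≡⟨ lookup-⊖e x i k ⟩
    lookup x k -ₚ (if does (k ≟ i) then 1ₚ else 0ₚ)         ≡⟨ cong (λ b → lookup x k -ₚ (if b then 1ₚ else 0ₚ)) (dec-false (k ≟ i) k≢i) ⟩
    lookup x k -ₚ 0ₚ                                        ≡⟨ -ₚ-identityʳ (lookup x k) ⟩
    lookup x k                                              ∎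
    where open ≡-Reasoning

  lookup-⊖e-self : ∀ {n} (x : V p n) i → lookup (x ⊖ e p i) i ≡ lookup x i -ₚ 1ₚ
  lookup-⊖e-self x i =
    trans (lookup-⊖e x i i) (cong (λ b → lookup x i -ₚ (if b then 1ₚ else 0ₚ)) (dec-true (i ≟ i) refl))

  ∈H+e⇔ : ∀ {n} (i : Fin n) (x : V p n) →
    (∀ k → toℕ k ≤ toℕ i → lookup (x ⊖ e p i) k ≡ 0ₚ) ⇔ (ZeroBelow i x × lookup x i ≡ 1ₚ)
  ∈H+e⇔ i x = mk⇔
    (λ shifted-zero →
       (λ k k<i → trans (sym (lookup-⊖e-≢ x (λ k≡i → <⇒≢ k<i (cong toℕ k≡i)))) (shifted-zero k (<⇒≤ k<i))) ,
       -ₚ≡0ₚ⇒≡ (trans (sym (lookup-⊖e-self x i)) (shifted-zero i ≤-refl)))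
    (λ { (zero-below , xᵢ≡1) k k≤i → at k k≤i zero-below xᵢ≡1 })
    where
    at : ∀ k → toℕ k ≤ toℕ i → ZeroBelow i x → lookup x i ≡ 1ₚ → lookup (x ⊖ e p i) k ≡ 0ₚ
    at k k≤i zero-below xᵢ≡1 with k ≟ i
    ... | yes refl = trans (lookup-⊖e-self x k) (trans (cong (_-ₚ 1ₚ) xᵢ≡1) (-ₚ-self 1ₚ))
    ... | no k≢i   = trans (lookup-⊖e-≢ x k≢i) (zero-below k (≤∧≢⇒< k≤i (λ eq → k≢i (toℕ-injective eq))))

  A-GS⇔ : ∀ {n} (x : V p n) → A-GS p n x ≡ true ⇔ (∃ λ i → ZeroBelow i x × lookup x i ≡ 1ₚ)
  A-GS⇔ {n} x = mk⇔
    (λ x∈A → let i , T-test = Any.satisfied (any⁻ test (allFin n) (Equivalence.from T-≡ x∈A))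
             in i , Equivalence.to (test⇔ i) T-test)
    (λ (i , leading-one) → Equivalence.to T-≡
       (any⁺ test (Any.map (λ { refl → Equivalence.from (test⇔ i) leading-one }) (∈-allFin i))))
    where
    test : Fin n → Bool
    test i = inH p i (x ⊖ e p i)
    test⇔ : ∀ i → T (test i) ⇔ (ZeroBelow i x × lookup x i ≡ 1ₚ)
    test⇔ i = ⇔-trans T-≡ (⇔-trans (inH⇔ i (x ⊖ e p i)) (∈H+e⇔ i x))

  A-GS⇒coordinate-0-or-1 : 1 < p → ∀ {n} {j} (x : V p n) → ZeroBelow j x → A-GS p n x ≡ true →
    lookup x j ≡ 0ₚ ⊎ lookup x j ≡ 1ₚ
  A-GS⇒coordinate-0-or-1 1<p {j = j} x zero-below-j x∈A
    with Equivalence.to (A-GS⇔ x) x∈A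
  ... | i , zero-below-i , xᵢ≡1 with <-cmp (toℕ i) (toℕ j)
  ...   | tri< i<j _ _ = ⊥-elim (1ₚ≢0ₚ 1<p (trans (sym xᵢ≡1) (zero-below-j i i<j)))
  ...   | tri≈ _ i≡j _ = inj₂ (subst (λ k → lookup x k ≡ 1ₚ) (toℕ-injective i≡j) xᵢ≡1)
  ...   | tri> _ _ j<i = inj₁ (zero-below-i j j<i)

  -- Counting in subgroups

  card-cong : ∀ {n} {B C : Subset p n} → (∀ y → B y ≡ C y) → card p B ≡ card p C
  card-cong {n} B≗C = ∑-cong (allV p n) (λ y → cong 𝟙 (B≗C y))

  fibre : ∀ {n} → Subset p n → Fin n → Fin p → ℕ
  fibre S j t = card p (λ y → S y ∧ does (lookup y j ≟ t))

  card≡∑fibre : ∀ {n} (S : Subset p n) (j : Fin n) → card p S ≡ ∑ (allFin p) (fibre S j)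
  card≡∑fibre {n} S j = begin
    ∑[ y ∈ allV p n ] 𝟙 (S y)
      ≡⟨ ∑-cong (allV p n) (λ y → ∑-allFin-δ p (lookup y j) (λ _ → 𝟙 (S y))) ⟨
    ∑[ y ∈ allV p n ] ∑[ t ∈ allFin p ] (if does (lookup y j ≟ t) then 𝟙 (S y) else 0)
      ≡⟨ ∑-comm (allV p n) (allFin p) _ ⟩
    ∑[ t ∈ allFin p ] ∑[ y ∈ allV p n ] (if does (lookup y j ≟ t) then 𝟙 (S y) else 0)
      ≡⟨ ∑-cong (allFin p) (λ t → ∑-cong (allV p n) (λ y → 𝟙-∧ (S y) _)) ⟩
    ∑ (allFin p) (fibre S j)
      ∎
    where open ≡-Reasoning

  module _ {n} {S : Subset p n} (S-subgroup : IsSubgroup p S) where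
    open IsSubgroup S-subgroup

    difference-closed : ∀ x z → S x ≡ true → S z ≡ true → S (x ⊖ z) ≡ true
    difference-closed x z x∈S z∈S =
      subst (λ y → S y ≡ true) (sym (⊖-as-⊕ x z)) (⊕-closed x (0v ⊖ z) x∈S (⊖-closed z z∈S))

    translation-invariant : ∀ {u} → S u ≡ true → ∀ y → S (y ⊕ u) ≡ S y
    translation-invariant {u} u∈S y with S y in y∈S?
    ... | true  = ⊕-closed y u y∈S? u∈S
    ... | false with S (y ⊕ u) in y+u∈S?
    ...   | false = refl
    ...   | true  = ⊥-elim (true≢false (trans (sym (difference-closed (y ⊕ u) u y+u∈S? u∈S))
                                              (trans (cong S (⊕-⊖ y u)) y∈S?)))
      where
      true≢false : true ≢ false
      true≢false ()

    fibre-translate : ∀ {u} → S u ≡ true → ∀ j t → fibre S j (t +ₚ lookup u j) ≡ fibre S j t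
    fibre-translate {u} u∈S j t = begin
      fibre S j (t +ₚ a)
        ≡⟨ ∑-allV-bijection (_⊕ u) (_⊖ u) (λ x → ⊕-⊖ x u) (λ y → ⊖-⊕ y u) _ ⟨
      ∑[ y ∈ allV p n ] 𝟙 (S (y ⊕ u) ∧ does (lookup (y ⊕ u) j ≟ t +ₚ a))
        ≡⟨ ∑-cong (allV p n) (λ y → cong 𝟙 (cong₂ _∧_ (translation-invariant u∈S y) (shifted-test y))) ⟩
      fibre S j t
        ∎
      where
      open ≡-Reasoning
      a = lookup u j
      shifted-test : ∀ y → does (lookup (y ⊕ u) j ≟ t +ₚ a) ≡ does (lookup y j ≟ t)
      shifted-test y = does-⇔
        (mk⇔ (λ eq → +ₚ-cancelʳ a (trans (sym (lookup-⊕ y u j)) eq))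
             (λ eq → trans (lookup-⊕ y u j) (cong (_+ₚ a) eq)))
        (lookup (y ⊕ u) j ≟ t +ₚ a) (lookup y j ≟ t)

    module _ (p-prime : Prime p) {u} (u∈S : S u ≡ true) {j} (uⱼ≢0 : lookup u j ≢ 0ₚ) where

      fibre-constant : ∀ t → fibre S j t ≡ fibre S j 0ₚ
      fibre-constant t =
        trans (cong (fibre S j) (sym (mod-toℕ t))) (coprime-periods⇒constant G p⊥uⱼ per-p per-uⱼ (toℕ t))
        where
        G : ℕ → ℕ
        G m = fibre S j (m mod p)
        per-p : ∀ m → G (m + p) ≡ G m
        per-p m = cong (fibre S j) (mod-+p m)
        per-uⱼ : ∀ m → G (m + toℕ (lookup u j)) ≡ G m
        per-uⱼ m = trans (cong (fibre S j) (mod-+ₚ m (lookup u j))) (fibre-translate u∈S j (m mod p))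
        p⊥uⱼ : Coprime p (toℕ (lookup u j))
        p⊥uⱼ = prime⇒coprime p-prime {{≢-nonZero (λ eq → uⱼ≢0 (toℕ-injective (trans eq (sym toℕ-0ₚ))))}}
                             (toℕ<n (lookup u j))

      card≡p*fibre : card p S ≡ p * fibre S j 0ₚ
      card≡p*fibre = trans (card≡∑fibre S j) (trans (∑-cong (allFin p) fibre-constant) (∑-allFin-const p _))

  module _ {n} (S : Subset p n) (j : Fin n) (S-zero-below : ∀ y → S y ≡ true → ZeroBelow j y) where

    fibre-1≤card-∩A-GS : fibre S j 1ₚ ≤ card p (λ y → S y ∧ A-GS p n y)
    fibre-1≤card-∩A-GS = ∑-mono-≤ (allV p n) pointwise
      where
      pointwise : ∀ y → 𝟙 (S y ∧ does (lookup y j ≟ 1ₚ)) ≤ 𝟙 (S y ∧ A-GS p n y)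
      pointwise y with S y in y∈S? | lookup y j ≟ 1ₚ
      ... | false | _        = z≤n
      ... | true  | no _     = z≤n
      ... | true  | yes yⱼ≡1 rewrite Equivalence.from (A-GS⇔ y) (j , S-zero-below y y∈S? , yⱼ≡1) = ≤-refl

    card-∩A-GS≤fibre-0+fibre-1 : 1 < p → card p (λ y → S y ∧ A-GS p n y) ≤ fibre S j 0ₚ + fibre S j 1ₚ
    card-∩A-GS≤fibre-0+fibre-1 1<p =
      ≤-trans (∑-mono-≤ (allV p n) pointwise) (≤-reflexive (∑-distrib-+ (allV p n) _ _))
      where
      pointwise : ∀ y → 𝟙 (S y ∧ A-GS p n y) ≤ 𝟙 (S y ∧ does (lookup y j ≟ 0ₚ)) + 𝟙 (S y ∧ does (lookup y j ≟ 1ₚ))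
      pointwise y with S y in y∈S? | A-GS p n y in y∈A?
      ... | false | _     = z≤n
      ... | true  | false = z≤n
      ... | true  | true with A-GS⇒coordinate-0-or-1 1<p y (S-zero-below y y∈S?) y∈A?
      ...   | inj₁ yⱼ≡0 rewrite dec-true (lookup y j ≟ 0ₚ) yⱼ≡0 = m≤m+n 1 _
      ...   | inj₂ yⱼ≡1 rewrite dec-true (lookup y j ≟ 1ₚ) yⱼ≡1 = m≤n+m 1 _

  VanishesAt : ∀ {n} → Subset p n → Fin n → Set
  VanishesAt S i = ∀ y → S y ≡ true → lookup y i ≡ 0ₚ

  vanishesAt? : ∀ {n} (S : Subset p n) i → Dec (VanishesAt S i)
  vanishesAt? S i = ∀ⱽ? (λ y → (S y ≟ᴮ true) →-dec (lookup y i ≟ 0ₚ))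

  vanishing-everywhere⇒card≤1 : ∀ {n} (S : Subset p n) → (∀ i → VanishesAt S i) → card p S ≤ 1
  vanishing-everywhere⇒card≤1 {n} S vanishes =
    ≤-trans (∑-mono-≤ (allV p n) pointwise) (≤-reflexive (∑-allV-δ n 0v (λ _ → 1)))
    where
    pointwise : ∀ y → 𝟙 (S y) ≤ (if does (0v ≟ⱽ y) then 1 else 0)
    pointwise y with S y in y∈S?
    ... | false = z≤n
    ... | true  rewrite dec-true (0v ≟ⱽ y) (sym (coordinates-zero⇒≡0v y (λ i → vanishes i y y∈S?))) = ≤-refl

  ¬VanishesAt⇒witness : ∀ {n} (S : Subset p n) {j} → ¬ VanishesAt S j → ∃ λ u → S u ≡ true × lookup u j ≢ 0ₚ
  ¬VanishesAt⇒witness S {j} ¬vanishes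
    with ¬∀ⱽ⇒∃¬ (λ y → (S y ≟ᴮ true) →-dec (lookup y j ≟ 0ₚ)) ¬vanishes
  ... | u , ¬[u∈S→uⱼ≡0] with S u in u∈S?
  ...   | true  = u , u∈S? , λ uⱼ≡0 → ¬[u∈S→uⱼ≡0] (λ _ → uⱼ≡0)
  ...   | false = ⊥-elim (¬[u∈S→uⱼ≡0] (λ ()))

  first-nonvanishing-coordinate : ∀ {n} (S : Subset p n) → 1 < card p S →
    ∃ λ j → ¬ VanishesAt S j × (∀ y → S y ≡ true → ZeroBelow j y)
  first-nonvanishing-coordinate {n} S 1<|S|
    with ¬∀⟶∃¬-smallest n (VanishesAt S) (vanishesAt? S) (λ vanishes → <⇒≱ 1<|S| (vanishing-everywhere⇒card≤1 S vanishes))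
  ... | j , ¬vanishes , earlier-vanish = j , ¬vanishes , zero-below
    where
    zero-below : ∀ y → S y ≡ true → ZeroBelow j y
    zero-below y y∈S k k<j = subst (λ i → lookup y i ≡ 0ₚ) inject-k≡k (earlier-vanish (fromℕ< k<j) y y∈S)
      where
      inject-k≡k : inject (fromℕ< k<j) ≡ k
      inject-k≡k = toℕ-injective (trans (toℕ-inject (fromℕ< k<j)) (toℕ-fromℕ< k<j))

  module _ (p-prime : Prime p) (3≤p : 3 ≤ p) where

    A-GS-not-atomic : ∀ {n K} (S : Subset p n) → IsSubgroup p S → IndexAtMost p S K → K < p ^ n →
      ¬ CosetsAtomic p 1 p (A-GS p n) S
    A-GS-not-atomic {n} S S-subgroup index K<pⁿ atomic
      with first-nonvanishing-coordinate S (m≤n*o∧n<m⇒1<o index K<pⁿ)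
    ... | j , ¬vanishes , S-zero-below with ¬VanishesAt⇒witness S ¬vanishes
    ... | u , u∈S , uⱼ≢0 =
      proportion-not-extreme 3≤p lower upper
        (subst₂ (λ c s → (c * p < 1 * s) ⊎ (p * s < c * p + 1 * s)) |S∩A|≡ |S|≡ (atomic 0v))
      where
      f : ℕ
      f = fibre S j 0ₚ
      fibre-1≡f : fibre S j 1ₚ ≡ f
      fibre-1≡f = fibre-constant S-subgroup p-prime u∈S uⱼ≢0 1ₚ
      lower : f ≤ card p (λ y → S y ∧ A-GS p n y)
      lower = subst (_≤ _) fibre-1≡f (fibre-1≤card-∩A-GS S j S-zero-below)
      upper : card p (λ y → S y ∧ A-GS p n y) ≤ f + f
      upper = subst (λ f₁ → _ ≤ f + f₁) fibre-1≡f (card-∩A-GS≤fibre-0+fibre-1 S j S-zero-below (<⇒≤ 3≤p))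
      |S|≡ : card p (λ y → S (y ⊖ 0v)) ≡ p * f
      |S|≡ = trans (card-cong (λ y → cong S (⊖-identityʳ y))) (card≡p*fibre S-subgroup p-prime u∈S uⱼ≢0)
      |S∩A|≡ : card p (λ y → S (y ⊖ 0v) ∧ A-GS p n y) ≡ card p (λ y → S y ∧ A-GS p n y)
      |S∩A|≡ = card-cong (λ y → cong (λ z → S z ∧ A-GS p n y) (⊖-identityʳ y))

proposition1p14 : ∀ (ℓ : Level) (p : ℕ) .{{_ : NonZero p}} → Prime p → 3 ≤ p →
    ObstructionToLinearAtomicity p ℓ (P-GS p)
proposition1p14 ℓ p p-prime 3≤p = A-GS-in-P-GS , eventually-disjoint
  where
  1<p : 1 < p
  1<p = <⇒≤ 3≤p

  A-GS-in-P-GS : ∀ N → Σ ℕ λ n → N ≤ n × Σ (Subset p n) λ A → P-GS p n A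
  A-GS-in-P-GS N = suc N , n≤1+n N , A-GS p (suc N) , suc N , s≤s z≤n , Iso-refl p (A-GS p (suc N))

  eventually-disjoint : ∀ (H : Class p ℓ) → IsEPGP p H → LinearlyAtomic p H →
    Σ ℕ λ N → ∀ n → N ≤ n → ∀ (A : Subset p n) → P-GS p n A → H n A → ⊥
  eventually-disjoint H H-epGP H-atomic with H-atomic 1 p (s≤s z≤n) (>-nonZero⁻¹ p)
  ... | K , N , atomic-subgroup = N + K , λ n N+K≤n A A∈P-GS A∈H →
    let S , S-subgroup , index , S-atomic = atomic-subgroup n (≤-trans (m≤m+n N K) N+K≤n) (A-GS p n) (A-GS∈H A∈P-GS A∈H)
        K<pⁿ = <-≤-trans (n<b^n 1<p K) (^-monoʳ-≤ p (≤-trans (m≤n+m K N) N+K≤n))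
    in A-GS-not-atomic p p-prime 3≤p S S-subgroup index K<pⁿ S-atomic
    where
    A-GS∈H : ∀ {n A} → P-GS p n A → H n A → H n (A-GS p n)
    A-GS∈H {A = A} (m , _ , A-GS≅A) A∈H with Iso⇒dim-≡ p 1<p A-GS≅A
    ... | refl = H-epGP A (A-GS p m) (Iso-sym p A-GS≅A) A∈H
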